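{- Let $a,b,v_0,v_1$ be positive integers and define $v_m=av_{m-1}+bv_{m-2}$ for $m\ge2$. Then for every positive integer $n$, $$Z\bigl(D_n(v_1,\underbrace{a,\dots,a}_{n-1};\,bv_0,\underbrace{b,\dots,b}_{n-2})\bigr)=v_n.$$
   Context: For positive integers $x_1,\dots,x_n$ and $y_1,\dots,y_{n-1}$, the caterpillar-bond graph $D_n(x_1,\dots,x_n;y_1,\dots,y_{n-1})$ is the multigraph with a central path of vertices $v'_1,\dots,v'_n$, where for each $k=1,\dots,n-1$ the vertices $v'_k$ and $v'_{k+1}$ are joined by exactly $y_k$ parallel edges, and where each $v'_k$ additionally has exactly $x_k-1$ pendant vertices attached to it by single edges; there are no other vertices or edges. (For $n=1$ the list of $y$'s is empty and $D_1(x_1)$ is a star with $x_1-1$ leaves.) For a finite multigraph $G$, the topological index (Hosoya index) is $Z(G)=\sum_{k\ge0}p(G,k)$, where $p(G,k)$ is the number of sets of $k$ pairwise disjoint edges of $G$ ($p(G,0)=1$), parallel edges being counted as distinct edges. -}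

module Defs where

open import Data.Nat using (ℕ; zero; suc; _+_; _*_; _∸_; _≡ᵇ_)
open import Data.Bool using (Bool; true; false; _∧_; not; if_then_else_)
open import Data.Product using (_×_; _,_)
open import Data.List using (List; []; _∷_; _++_; map; length; replicate; upTo)
open import Data.Nat.ListAction using (sum)
open import Data.Vec using (Vec; []; _∷_)

-- A finite multigraph is given by its vertex list and its
-- edge list; parallel edges are distinct list entries.
Vertex : Set
Vertex = ℕ × ℕ

Edge : Set
Edge = Vertex × Vertex

record MultiGraph : Set where
  field
    vertices : List Vertex
    edges    : List Edge
open MultiGraph public

_==ᵛ_ : Vertex → Vertex → Bool
(a , b) ==ᵛ (c , d) = (a ≡ᵇ c) ∧ (b ≡ᵇ d)

disjoint : Edge → Edge → Bool
disjoint (u , w) (u' , w') =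
  not (u ==ᵛ u') ∧ not (u ==ᵛ w') ∧ not (w ==ᵛ u') ∧ not (w ==ᵛ w')

allB : {A : Set} → (A → Bool) → List A → Bool
allB p [] = true
allB p (x ∷ xs) = p x ∧ allB p xs

pairwiseDisjoint : List Edge → Bool
pairwiseDisjoint [] = true
pairwiseDisjoint (e ∷ es) = allB (disjoint e) es ∧ pairwiseDisjoint es

-- all sub-lists (by position), i.e. all subsets of the edge multiset with
-- parallel edges counted as distinct
sublists : {A : Set} → List A → List (List A)
sublists [] = [] ∷ []
sublists (x ∷ xs) = sublists xs ++ map (x ∷_) (sublists xs)

count : {A : Set} → (A → Bool) → List A → ℕ
count p [] = 0
count p (x ∷ xs) = (if p x then 1 else 0) + count p xs

p : MultiGraph → ℕ → ℕ
p G k = count (λ s → pairwiseDisjoint s ∧ (length s ≡ᵇ k)) (sublists (edges G))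

-- Hosoya index Z(G) = Σ_{k ≥ 0} p(G,k)  (p(G,k) = 0 for k > |E(G)|)
Z : MultiGraph → ℕ
Z G = sum (map (p G) (upTo (suc (length (edges G)))))

-- Caterpillar-bond graph.  Path vertex v'_{k+1} is (k , 0); its pendant
-- vertices are (k , 1) , … , (k , x_{k+1} - 1).
pendantVertices : ℕ → ℕ → List Vertex
pendantVertices k x = map (λ j → (k , suc j)) (upTo (x ∸ 1))

pendantEdges : ℕ → ℕ → List Edge
pendantEdges k x = map (λ j → ((k , 0) , (k , suc j))) (upTo (x ∸ 1))

bondEdges : ℕ → ℕ → List Edge
bondEdges k y = replicate y ((k , 0) , (suc k , 0))

DVerts : {m : ℕ} → ℕ → Vec ℕ (suc m) → List Vertex
DVerts k (x ∷ []) = (k , 0) ∷ pendantVertices k x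
DVerts k (x ∷ x' ∷ xs) = ((k , 0) ∷ pendantVertices k x) ++ DVerts (suc k) (x' ∷ xs)

DEdges : {m : ℕ} → ℕ → Vec ℕ (suc m) → Vec ℕ m → List Edge
DEdges k (x ∷ []) [] = pendantEdges k x
DEdges k (x ∷ x' ∷ xs) (y ∷ ys) = pendantEdges k x ++ bondEdges k y ++ DEdges (suc k) (x' ∷ xs) ys

-- D_n(x_1,…,x_n ; y_1,…,y_{n-1}) with n = suc m
D : (m : ℕ) → Vec ℕ (suc m) → Vec ℕ m → MultiGraph
D m xs ys = record { vertices = DVerts 0 xs ; edges = DEdges 0 xs ys }

seqV : ℕ → ℕ → ℕ → ℕ → ℕ → ℕ
seqV a b v0 v1 zero = v0
seqV a b v0 v1 (suc zero) = v1
seqV a b v0 v1 (suc (suc m)) = a * seqV a b v0 v1 (suc m) + b * seqV a b v0 v1 m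

xList : (m : ℕ) → ℕ → ℕ → Vec ℕ (suc m)
xList m a v1 = v1 ∷ Data.Vec.replicate m a

yList : (m : ℕ) → ℕ → ℕ → Vec ℕ m
yList zero b v0 = []
yList (suc m) b v0 = (b * v0) ∷ Data.Vec.replicate m b

module Submission where

-- 1. Matchings are counted relative to a set of still-available vertices:
--    N α E is the number of matchings inside the edge list E that only
--    touch vertices in α.  Deciding whether the first edge is used gives
--    N α (e ∷ E) = N α E + [e usable] · N (α minus the ends of e) E.
-- 2. Iterating this over a "star" of edges through a common centre c: once
--    one of them is chosen, all others are blocked, so a star of s usable
--    edges, each leaving V matchings on the rest, contributes s · V.
-- 3. The edge list of D consists, per spine vertex, of a star (pendants and
--    bonds to the next spine vertex) followed by the rest of the graph.
--    Induction along the spine shows that N equals caterpillarZ, the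
--    explicit first-vertex recursion Z = x·Z(tail) + y·Z(tail minus its
--    first vertex).
-- 4. Z, defined as Σ_k p(G,k), equals N with all vertices available.
-- 5. For the lists (v₁, a, …, a ; b v₀, b, …, b) the recursion unfolds to
--    v₁·u_m + b v₀·u_{m-1} with the uniform caterpillar values u, and the
--    same linear combination satisfies the recurrence of v.

open import Defs
open import Data.Nat using (ℕ; zero; suc; _>_; _+_; _*_; _∸_; _≡ᵇ_; _≤_; _<_; z≤n; s≤s)
open import Data.Nat.Properties
  using (≤-refl; <⇒≤; n≤1+n; n<1+n; *-identityʳ; m≤n⇒m≤1+n; m<n⇒m<1+n; <-≤-trans; +-assoc; +-comm; +-identityʳ; +-commutativeSemigroup)
open import Data.Nat.ListAction using (sum)
open import Data.Nat.Tactic.RingSolver using (solve-∀)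
open import Data.Bool using (Bool; true; false; _∧_; not; if_then_else_)
open import Data.Bool.Properties using (∧-assoc; ∧-comm; ∧-zeroʳ; ∧-commutativeMonoid)
open import Data.Product using (_×_; _,_; proj₁; proj₂)
open import Data.List using (List; []; _∷_; _++_; map; length; upTo; applyUpTo)
open import Data.List.Properties using (length-map; length-upTo; length-replicate; ++-identityʳ; map-upTo)
open import Data.List.Relation.Unary.All as All using (All; []; _∷_)
open import Data.List.Relation.Unary.All.Properties using (++⁺; map⁺; replicate⁺)
open import Data.Vec using (Vec; []; _∷_)
import Data.Vec as Vec
open import Algebra.Bundles using (CommutativeMonoid)
open import Algebra.Properties.CommutativeSemigroup
  (CommutativeMonoid.commutativeSemigroup ∧-commutativeMonoid) using () renaming (interchange to ∧-interchange)
open import Algebra.Properties.CommutativeSemigroup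
  +-commutativeSemigroup using () renaming (interchange to +-interchange)
open import Relation.Binary.PropositionalEquality using (_≡_; refl; sym; trans; cong; cong₂; module ≡-Reasoning)
open ≡-Reasoning

count-++ : {A : Set} (q : A → Bool) (xs ys : List A) → count q (xs ++ ys) ≡ count q xs + count q ys
count-++ q [] ys = refl
count-++ q (x ∷ xs) ys =
  trans (cong ((if q x then 1 else 0) +_) (count-++ q xs ys)) (sym (+-assoc (if q x then 1 else 0) _ _))

count-map : {A B : Set} (q : B → Bool) (f : A → B) (xs : List A) → count q (map f xs) ≡ count (λ x → q (f x)) xs
count-map q f [] = refl
count-map q f (x ∷ xs) = cong ((if q (f x) then 1 else 0) +_) (count-map q f xs)

count-ext : {A : Set} {q r : A → Bool} → (∀ x → q x ≡ r x) → (xs : List A) → count q xs ≡ count r xs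
count-ext q≡r [] = refl
count-ext q≡r (x ∷ xs) = cong₂ (λ b n → (if b then 1 else 0) + n) (q≡r x) (count-ext q≡r xs)

count-guard : {A : Set} (c : Bool) (q : A → Bool) (xs : List A) → count (λ x → c ∧ q x) xs ≡ (if c then count q xs else 0)
count-guard true q xs = refl
count-guard false q [] = refl
count-guard false q (x ∷ xs) = count-guard false q xs

≡ᵇ-refl : ∀ n → (n ≡ᵇ n) ≡ true
≡ᵇ-refl zero = refl
≡ᵇ-refl (suc n) = ≡ᵇ-refl n

<⇒≢ᵇ : ∀ {k i} → k < i → (k ≡ᵇ i) ≡ false
<⇒≢ᵇ {zero} {suc i} _ = refl
<⇒≢ᵇ {suc k} {suc i} (s≤s k<i) = <⇒≢ᵇ k<i

==ᵛ-refl : ∀ v → (v ==ᵛ v) ≡ true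
==ᵛ-refl (i , j) = cong₂ _∧_ (≡ᵇ-refl i) (≡ᵇ-refl j)

column-<⇒≢ : ∀ {k i} a j → k < i → ((k , a) ==ᵛ (i , j)) ≡ false
column-<⇒≢ a j k<i = cong (_∧ (a ≡ᵇ j)) (<⇒≢ᵇ k<i)

-- Matchings avoiding covered vertices.  α marks the vertices that are
-- still available; an edge is usable when both of its ends are available,
-- and choosing it removes its ends from α.

Available : Set
Available = Vertex → Bool

usable : Available → Edge → Bool
usable α (u , w) = α u ∧ α w

cover : Available → Edge → Available
cover α (u , w) v = (not (u ==ᵛ v) ∧ not (w ==ᵛ v)) ∧ α v

isMatchingIn : Available → List Edge → Bool
isMatchingIn α [] = true
isMatchingIn α (e ∷ s) = usable α e ∧ isMatchingIn (cover α e) s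

N : Available → List Edge → ℕ
N α E = count (isMatchingIn α) (sublists E)

cover-covers-first : ∀ α u w → cover α (u , w) u ≡ false
cover-covers-first α u w rewrite ==ᵛ-refl u = refl

cover-covers-second : ∀ α u w → cover α (u , w) w ≡ false
cover-covers-second α u w rewrite ==ᵛ-refl w = cong (_∧ α w) (∧-zeroʳ (not (u ==ᵛ w)))

usable-cover : ∀ α e f → usable (cover α e) f ≡ disjoint e f ∧ usable α f
usable-cover α (u , w) (u' , w') = begin
  ((d₁ ∧ d₃) ∧ α u') ∧ ((d₂ ∧ d₄) ∧ α w')  ≡⟨ ∧-interchange (d₁ ∧ d₃) (α u') (d₂ ∧ d₄) (α w') ⟩
  ((d₁ ∧ d₃) ∧ (d₂ ∧ d₄)) ∧ usable α f     ≡⟨ cong (_∧ usable α f) (∧-interchange d₁ d₃ d₂ d₄) ⟩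
  ((d₁ ∧ d₂) ∧ (d₃ ∧ d₄)) ∧ usable α f     ≡⟨ cong (_∧ usable α f) (∧-assoc d₁ d₂ (d₃ ∧ d₄)) ⟩
  disjoint (u , w) f ∧ usable α f          ∎
  where
  f : Edge
  f = (u' , w')
  d₁ d₂ d₃ d₄ : Bool
  d₁ = not (u ==ᵛ u')
  d₂ = not (u ==ᵛ w')
  d₃ = not (w ==ᵛ u')
  d₄ = not (w ==ᵛ w')

allB-usable-cover : ∀ α e s → allB (usable (cover α e)) s ≡ allB (disjoint e) s ∧ allB (usable α) s
allB-usable-cover α e [] = refl
allB-usable-cover α e (f ∷ s) =
  trans (cong₂ _∧_ (usable-cover α e f) (allB-usable-cover α e s))
        (∧-interchange (disjoint e f) (usable α f) (allB (disjoint e) s) (allB (usable α) s))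

isMatchingIn-spec : ∀ α s → isMatchingIn α s ≡ allB (usable α) s ∧ pairwiseDisjoint s
isMatchingIn-spec α [] = refl
isMatchingIn-spec α (e ∷ s) = begin
  u ∧ isMatchingIn (cover α e) s  ≡⟨ cong (u ∧_) (isMatchingIn-spec (cover α e) s) ⟩
  u ∧ (allB (usable (cover α e)) s ∧ P)  ≡⟨ cong (λ z → u ∧ (z ∧ P)) (allB-usable-cover α e s) ⟩
  u ∧ ((δ ∧ U) ∧ P)  ≡⟨ cong (λ z → u ∧ (z ∧ P)) (∧-comm δ U) ⟩
  u ∧ ((U ∧ δ) ∧ P)  ≡⟨ cong (u ∧_) (∧-assoc U δ P) ⟩
  u ∧ (U ∧ (δ ∧ P))  ≡⟨ sym (∧-assoc u U (δ ∧ P)) ⟩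
  (u ∧ U) ∧ (δ ∧ P)  ∎
  where
  u U δ P : Bool
  u = usable α e
  U = allB (usable α) s
  δ = allB (disjoint e) s
  P = pairwiseDisjoint s

-- Every sublist either omits the first edge or starts with it.
N-cons : ∀ α e E → N α (e ∷ E) ≡ N α E + (if usable α e then N (cover α e) E else 0)
N-cons α e E = begin
  count M (sublists E ++ map (e ∷_) (sublists E))
    ≡⟨ count-++ M (sublists E) (map (e ∷_) (sublists E)) ⟩
  N α E + count M (map (e ∷_) (sublists E))
    ≡⟨ cong (N α E +_) (count-map M (e ∷_) (sublists E)) ⟩
  N α E + count (λ s → usable α e ∧ isMatchingIn (cover α e) s) (sublists E)
    ≡⟨ cong (N α E +_) (count-guard (usable α e) (isMatchingIn (cover α e)) (sublists E)) ⟩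
  N α E + (if usable α e then N (cover α e) E else 0) ∎
  where
  M : List Edge → Bool
  M = isMatchingIn α

N-drop : ∀ α e E → usable α e ≡ false → N α (e ∷ E) ≡ N α E
N-drop α e E unusable rewrite N-cons α e E | unusable = +-identityʳ (N α E)

N-take : ∀ α e E → usable α e ≡ true → N α (e ∷ E) ≡ N α E + N (cover α e) E
N-take α e E usable-e rewrite N-cons α e E | usable-e = refl

N-skip : ∀ α E R → All (λ e → usable α e ≡ false) E → N α (E ++ R) ≡ N α R
N-skip α [] R [] = refl
N-skip α (e ∷ E) R (unusable ∷ E-unusable) = trans (N-drop α e (E ++ R) unusable) (N-skip α E R E-unusable)

-- If every edge of E starts at the centre c and is usable, then
-- choosing one of them blocks all the others, so each edge of E contributes
-- the number V of matchings it leaves on the remaining edges R.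

Centred : Available → Vertex → Edge → Set
Centred α c e = (proj₁ e ≡ c) × (usable α e ≡ true)

centred-blocked : ∀ α c w E → All (Centred α c) E → All (λ e → usable (cover α (c , w)) e ≡ false) E
centred-blocked α c w E = All.map blocked
  where
  blocked : ∀ {e} → Centred α c e → usable (cover α (c , w)) e ≡ false
  blocked {.c , w'} (refl , _) = cong (_∧ cover α (c , w) w') (cover-covers-first α c w)

N-star : ∀ α c E R V → All (Centred α c) E → All (λ e → N (cover α e) R ≡ V) E →
  N α (E ++ R) ≡ N α R + length E * V
N-star α c [] R V [] [] = sym (+-identityʳ (N α R))
N-star α c ((.c , w) ∷ E) R V ((refl , usable-e) ∷ centred) (leaves-V ∷ leave-V) = begin
  N α ((c , w) ∷ E ++ R)                              ≡⟨ N-take α (c , w) (E ++ R) usable-e ⟩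
  N α (E ++ R) + N (cover α (c , w)) (E ++ R)         ≡⟨ cong₂ _+_ (N-star α c E R V centred leave-V) rest-blocked ⟩
  (N α R + length E * V) + V                          ≡⟨ +-assoc (N α R) (length E * V) V ⟩
  N α R + (length E * V + V)                          ≡⟨ cong (N α R +_) (+-comm (length E * V) V) ⟩
  N α R + length ((c , w) ∷ E) * V                    ∎
  where
  rest-blocked : N (cover α (c , w)) (E ++ R) ≡ V
  rest-blocked = trans (N-skip (cover α (c , w)) E R (centred-blocked α c w E centred)) leaves-V

AvailableFrom : Available → ℕ → Set
AvailableFrom α k = ∀ i j → k ≤ i → α (i , j) ≡ true

availableFrom-suc : ∀ {α k} → AvailableFrom α k → AvailableFrom α (suc k)
availableFrom-suc avail i j k<i = avail i j (<⇒≤ k<i)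

cover-availableFrom : ∀ {α m k₁ k₂} a₁ a₂ → AvailableFrom α m → k₁ < m → k₂ < m →
  AvailableFrom (cover α ((k₁ , a₁) , (k₂ , a₂))) m
cover-availableFrom {k₁ = k₁} {k₂} a₁ a₂ avail k₁<m k₂<m i j m≤i
  rewrite column-<⇒≢ a₁ j (<-≤-trans k₁<m m≤i) | column-<⇒≢ a₂ j (<-≤-trans k₂<m m≤i) = avail i j m≤i

Spoke : ℕ → Edge → Set
Spoke k e = (proj₁ e ≡ (k , 0)) × (k ≤ proj₁ (proj₂ e))

pendant-spokes : ∀ k x → All (Spoke k) (pendantEdges k x)
pendant-spokes k x = map⁺ (All.universal (λ j → refl , ≤-refl) (upTo (x ∸ 1)))

bond-spokes : ∀ k y → All (Spoke k) (bondEdges k y)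
bond-spokes k y = replicate⁺ y (refl , n≤1+n k)

spokes-centred : ∀ α {k E} → AvailableFrom α k → All (Spoke k) E → All (Centred α (k , 0)) E
spokes-centred α {k} avail = All.map centred
  where
  centred : ∀ {e} → Spoke k e → Centred α (k , 0) e
  centred {.(k , 0) , (i , j)} (refl , k≤i) = refl , cong₂ _∧_ (avail k 0 ≤-refl) (avail i j k≤i)

spokes-blocked : ∀ α {k E} → α (k , 0) ≡ false → All (Spoke k) E → All (λ e → usable α e ≡ false) E
spokes-blocked α {k} covered = All.map blocked
  where
  blocked : ∀ {e} → Spoke k e → usable α e ≡ false
  blocked {.(k , 0) , w} (refl , _) = cong (_∧ α w) covered

length-pendantEdges : ∀ k x → length (pendantEdges k x) ≡ x ∸ 1
length-pendantEdges k x = trans (length-map _ (upTo (x ∸ 1))) (length-upTo (x ∸ 1))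

-- The predicted Hosoya index of D(xs ; ys), and of D(xs ; ys) with its first
-- spine vertex deleted.  The first spine vertex is unmatched, matched by
-- one of the y bonds, or matched by one of its x - 1 pendant edges.
mutual
  caterpillarZ : ∀ {m} → Vec ℕ (suc m) → Vec ℕ m → ℕ
  caterpillarZ (x ∷ []) [] = 1 + (x ∸ 1)
  caterpillarZ (x ∷ x' ∷ xs) (y ∷ ys) =
    (caterpillarZ (x' ∷ xs) ys + y * caterpillarZ⁻ (x' ∷ xs) ys) + (x ∸ 1) * caterpillarZ (x' ∷ xs) ys

  caterpillarZ⁻ : ∀ {m} → Vec ℕ (suc m) → Vec ℕ m → ℕ
  caterpillarZ⁻ (x ∷ []) [] = 1
  caterpillarZ⁻ (x ∷ x' ∷ xs) (y ∷ ys) = caterpillarZ (x' ∷ xs) ys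

mutual
  count-available : ∀ {m} k (xs : Vec ℕ (suc m)) (ys : Vec ℕ m) α → AvailableFrom α k →
    N α (DEdges k xs ys) ≡ caterpillarZ xs ys
  count-available k (x ∷ []) [] α avail = begin
    N α P                  ≡⟨ cong (N α) (sym (++-identityʳ P)) ⟩
    N α (P ++ [])          ≡⟨ N-star α (k , 0) P [] 1 (spokes-centred α avail (pendant-spokes k x)) (All.universal (λ _ → refl) P) ⟩
    1 + length P * 1       ≡⟨ cong (1 +_) (trans (*-identityʳ (length P)) (length-pendantEdges k x)) ⟩
    1 + (x ∸ 1)            ∎
    where
    P : List Edge
    P = pendantEdges k x
  count-available k (x ∷ x' ∷ xs) (y ∷ ys) α avail = begin
    N α (P ++ B ++ rest)
      ≡⟨ N-star α (k , 0) P (B ++ rest) r (spokes-centred α avail (pendant-spokes k x))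
                (map⁺ (All.universal after-pendant (upTo (x ∸ 1)))) ⟩
    N α (B ++ rest) + length P * r
      ≡⟨ cong₂ _+_ bonds (cong (_* r) (length-pendantEdges k x)) ⟩
    (r + y * r⁻) + (x ∸ 1) * r
      ∎
    where
    P B rest : List Edge
    P = pendantEdges k x
    B = bondEdges k y
    rest = DEdges (suc k) (x' ∷ xs) ys
    r r⁻ : ℕ
    r = caterpillarZ (x' ∷ xs) ys
    r⁻ = caterpillarZ⁻ (x' ∷ xs) ys

    -- a pendant edge covers (k , 0), which blocks all bonds
    after-pendant : ∀ j → N (cover α ((k , 0) , (k , suc j))) (B ++ rest) ≡ r
    after-pendant j = begin
      N α' (B ++ rest)  ≡⟨ N-skip α' B rest (spokes-blocked α' (cover-covers-first α (k , 0) (k , suc j)) (bond-spokes k y)) ⟩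
      N α' rest         ≡⟨ count-available (suc k) (x' ∷ xs) ys α'
                             (cover-availableFrom 0 (suc j) (availableFrom-suc avail) (n<1+n k) (n<1+n k)) ⟩
      r                 ∎
      where
      α' : Available
      α' = cover α ((k , 0) , (k , suc j))

    -- a bond edge covers the next spine vertex (k + 1 , 0)
    after-bond : N (cover α ((k , 0) , (suc k , 0))) rest ≡ r⁻
    after-bond = count-covered (suc k) (x' ∷ xs) ys (cover α ((k , 0) , (suc k , 0)))
      (cover-covers-second α (k , 0) (suc k , 0))
      (cover-availableFrom 0 0 (availableFrom-suc (availableFrom-suc avail)) (m<n⇒m<1+n (n<1+n k)) (n<1+n (suc k)))

    bonds : N α (B ++ rest) ≡ r + y * r⁻
    bonds = begin
      N α (B ++ rest)                ≡⟨ N-star α (k , 0) B rest r⁻ (spokes-centred α avail (bond-spokes k y)) (replicate⁺ y after-bond) ⟩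
      N α rest + length B * r⁻       ≡⟨ cong₂ _+_ (count-available (suc k) (x' ∷ xs) ys α (availableFrom-suc avail))
                                                  (cong (_* r⁻) (length-replicate y)) ⟩
      r + y * r⁻                     ∎

  count-covered : ∀ {m} k (xs : Vec ℕ (suc m)) (ys : Vec ℕ m) α → α (k , 0) ≡ false → AvailableFrom α (suc k) →
    N α (DEdges k xs ys) ≡ caterpillarZ⁻ xs ys
  count-covered k (x ∷ []) [] α covered avail =
    trans (cong (N α) (sym (++-identityʳ (pendantEdges k x))))
          (N-skip α (pendantEdges k x) [] (spokes-blocked α covered (pendant-spokes k x)))
  count-covered k (x ∷ x' ∷ xs) (y ∷ ys) α covered avail = begin
    N α (pendantEdges k x ++ bondEdges k y ++ rest)
      ≡⟨ N-skip α (pendantEdges k x) (bondEdges k y ++ rest) (spokes-blocked α covered (pendant-spokes k x)) ⟩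
    N α (bondEdges k y ++ rest)
      ≡⟨ N-skip α (bondEdges k y) rest (spokes-blocked α covered (bond-spokes k y)) ⟩
    N α rest
      ≡⟨ count-available (suc k) (x' ∷ xs) ys α avail ⟩
    caterpillarZ (x' ∷ xs) ys
      ∎
    where
    rest : List Edge
    rest = DEdges (suc k) (x' ∷ xs) ys

-- Z counts all matchings.  Z G sums, over k ≤ |E|, the number of matchings
-- of size k; since every sublist has length ≤ |E| it is counted exactly once.

sum-zeros : ∀ n → sum (applyUpTo (λ _ → 0) n) ≡ 0
sum-zeros zero = refl
sum-zeros (suc n) = sum-zeros n

sum-applyUpTo-+ : ∀ (f g : ℕ → ℕ) n → sum (applyUpTo (λ k → f k + g k) n) ≡ sum (applyUpTo f n) + sum (applyUpTo g n)
sum-applyUpTo-+ f g zero = refl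
sum-applyUpTo-+ f g (suc n) =
  trans (cong (f 0 + g 0 +_) (sum-applyUpTo-+ (λ k → f (suc k)) (λ k → g (suc k)) n))
        (+-interchange (f 0) (g 0) _ _)

sum-indicator : ∀ n L → n < L → sum (applyUpTo (λ k → if n ≡ᵇ k then 1 else 0) L) ≡ 1
sum-indicator zero (suc L) _ = cong suc (sum-zeros L)
sum-indicator (suc n) (suc L) (s≤s n<L) = sum-indicator n L n<L

sum-by-length : ∀ {A : Set} (q : List A → Bool) L (S : List (List A)) → All (λ s → length s ≤ L) S →
  sum (applyUpTo (λ k → count (λ s → q s ∧ (length s ≡ᵇ k)) S) (suc L)) ≡ count q S
sum-by-length q L [] [] = sum-zeros (suc L)
sum-by-length q L (s ∷ S) (s≤L ∷ S≤L) =
  trans (sum-applyUpTo-+ (λ k → if q s ∧ (length s ≡ᵇ k) then 1 else 0)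
                         (λ k → count (λ s' → q s' ∧ (length s' ≡ᵇ k)) S) (suc L))
        (cong₂ _+_ counted-once (sum-by-length q L S S≤L))
  where
  counted-once : sum (applyUpTo (λ k → if q s ∧ (length s ≡ᵇ k) then 1 else 0) (suc L)) ≡ (if q s then 1 else 0)
  counted-once with q s
  ... | true = sum-indicator (length s) (suc L) (s≤s s≤L)
  ... | false = sum-zeros (suc L)

sublists-length : ∀ {A : Set} (E : List A) → All (λ s → length s ≤ length E) (sublists E)
sublists-length [] = z≤n ∷ []
sublists-length (e ∷ E) = ++⁺ (All.map m≤n⇒m≤1+n (sublists-length E)) (map⁺ (All.map s≤s (sublists-length E)))

everything : Available
everything _ = true

allB-usable-everything : ∀ s → allB (usable everything) s ≡ true
allB-usable-everything [] = refl
allB-usable-everything (e ∷ s) = allB-usable-everything s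

Z≡N : ∀ G → Z G ≡ N everything (edges G)
Z≡N G = begin
  sum (map (p G) (upTo (suc (length E))))      ≡⟨ cong sum (map-upTo (p G) (suc (length E))) ⟩
  sum (applyUpTo (p G) (suc (length E)))       ≡⟨ sum-by-length pairwiseDisjoint (length E) (sublists E) (sublists-length E) ⟩
  count pairwiseDisjoint (sublists E)          ≡⟨ count-ext matching (sublists E) ⟩
  N everything E                               ∎
  where
  E : List Edge
  E = edges G
  matching : ∀ s → pairwiseDisjoint s ≡ isMatchingIn everything s
  matching s = sym (trans (isMatchingIn-spec everything s) (cong (_∧ pairwiseDisjoint s) (allB-usable-everything s)))

caterpillarZ-first : ∀ {m} x' y (xs : Vec ℕ (suc m)) (ys : Vec ℕ m) →
  caterpillarZ (suc x' ∷ xs) (y ∷ ys) ≡ suc x' * caterpillarZ xs ys + y * caterpillarZ⁻ xs ys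
caterpillarZ-first x' y (x ∷ xs) ys = regroup x' y (caterpillarZ (x ∷ xs) ys) (caterpillarZ⁻ (x ∷ xs) ys)
  where
  regroup : ∀ x' y r r⁻ → (r + y * r⁻) + x' * r ≡ suc x' * r + y * r⁻
  regroup = solve-∀

uniformZ uniformZ⁻ : ℕ → ℕ → ℕ → ℕ
uniformZ a b m = caterpillarZ (a ∷ Vec.replicate m a) (Vec.replicate m b)
uniformZ⁻ a b m = caterpillarZ⁻ (a ∷ Vec.replicate m a) (Vec.replicate m b)

uniformZ-suc : ∀ a' b m → uniformZ (suc a') b (suc m) ≡ suc a' * uniformZ (suc a') b m + b * uniformZ⁻ (suc a') b m
uniformZ-suc a' b m = caterpillarZ-first a' b (suc a' ∷ Vec.replicate m (suc a')) (Vec.replicate m b)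

seqV-shift : ∀ a b v0 v1 n → seqV a b v0 v1 (suc n) ≡ seqV a b v1 (a * v1 + b * v0) n
seqV-shift a b v0 v1 zero = refl
seqV-shift a b v0 v1 (suc zero) = refl
seqV-shift a b v0 v1 (suc (suc n)) =
  cong₂ (λ s t → a * s + b * t) (seqV-shift a b v0 v1 (suc n)) (seqV-shift a b v0 v1 n)

-- v_{m+2} = v₁ · u_{m+1} + b v₀ · u_m, where u_{m+1} = uniformZ m and u_m = uniformZ⁻ m.
seqV-uniform : ∀ a' b m v0 v1 →
  seqV (suc a') b v0 v1 (suc (suc m)) ≡ v1 * uniformZ (suc a') b m + b * v0 * uniformZ⁻ (suc a') b m
seqV-uniform a' b zero v0 v1 = base a' b v0 v1
  where
  base : ∀ a' b v0 v1 → suc a' * v1 + b * v0 ≡ v1 * (1 + a') + b * v0 * 1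
  base = solve-∀
seqV-uniform a' b (suc m) v0 v1 = begin
  seqV a b v0 v1 (3 + m)                      ≡⟨ seqV-shift a b v0 v1 (2 + m) ⟩
  seqV a b v1 (a * v1 + b * v0) (2 + m)       ≡⟨ seqV-uniform a' b m v1 (a * v1 + b * v0) ⟩
  (a * v1 + b * v0) * u + b * v1 * u⁻         ≡⟨ regroup a b v0 v1 u u⁻ ⟩
  v1 * (a * u + b * u⁻) + b * v0 * u          ≡⟨ cong (λ t → v1 * t + b * v0 * u) (sym (uniformZ-suc a' b m)) ⟩
  v1 * uniformZ a b (suc m) + b * v0 * u      ∎
  where
  a u u⁻ : ℕ
  a = suc a'
  u = uniformZ a b m
  u⁻ = uniformZ⁻ a b m
  regroup : ∀ a b v0 v1 u u⁻ → (a * v1 + b * v0) * u + b * v1 * u⁻ ≡ v1 * (a * u + b * u⁻) + b * v0 * u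
  regroup = solve-∀

caterpillarZ-seqV : ∀ a' b v0 v1' m →
  caterpillarZ (xList m (suc a') (suc v1')) (yList m b v0) ≡ seqV (suc a') b v0 (suc v1') (suc m)
caterpillarZ-seqV a' b v0 v1' zero = refl
caterpillarZ-seqV a' b v0 v1' (suc m) =
  trans (caterpillarZ-first v1' (b * v0) (suc a' ∷ Vec.replicate m (suc a')) (Vec.replicate m b))
        (sym (seqV-uniform a' b m v0 (suc v1')))

corollary2 : (a b v0 v1 : ℕ) → a > 0 → b > 0 → v0 > 0 → v1 > 0 →
    (m : ℕ) → Z (D m (xList m a v1) (yList m b v0)) ≡ seqV a b v0 v1 (suc m)
corollary2 (suc a') b v0 (suc v1') (s≤s z≤n) _ _ (s≤s z≤n) m = begin
  Z (D m xs ys)                    ≡⟨ Z≡N (D m xs ys) ⟩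
  N everything (DEdges 0 xs ys)    ≡⟨ count-available 0 xs ys everything (λ _ _ _ → refl) ⟩
  caterpillarZ xs ys               ≡⟨ caterpillarZ-seqV a' b v0 v1' m ⟩
  seqV (suc a') b v0 (suc v1') (suc m) ∎
  where
  xs : Vec ℕ (suc m)
  xs = xList m (suc a') (suc v1')
  ys : Vec ℕ m
  ys = yList m b v0
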